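{- Let $G=K_{p,q}$ be the complete bipartite graph with integers $q\ge p\ge 2$. Then $C_{tr}(K_{p,q})=p+q$.
   Context: A set $S\subseteq V$ is a total restrained dominating set (TRD-set) of $G=(V,E)$ if every vertex of $V\setminus S$ is adjacent to at least one vertex of $S$ and to at least one other vertex of $V\setminus S$, and every vertex of $S$ is adjacent to at least one other vertex of $S$. Two disjoint sets $X,Y\subseteq V$ form a total restrained coalition if neither is a TRD-set but $X\cup Y$ is a TRD-set. A trc-partition of $G$ is a partition $\Phi$ of $V$ such that no member of $\Phi$ is a TRD-set and each member forms a total restrained coalition with some other member of $\Phi$. $C_{tr}(G)$ is the maximum cardinality of a trc-partition of $G$. -}

module Defs where

open import Data.Nat using (ℕ; _+_; _<_; _≤_)
open import Data.Fin using (Fin; toℕ)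
open import Data.Product using (Σ; _×_; ∃; ∃-syntax)
open import Data.Sum using (_⊎_)
open import Relation.Nullary using (¬_)
open import Relation.Binary.PropositionalEquality using (_≡_; _≢_)

record Graph (n : ℕ) : Set₁ where
  field
    Adj   : Fin n → Fin n → Set
    sym   : ∀ {u v} → Adj u v → Adj v u
    irrefl : ∀ {v} → ¬ Adj v v

VSet : ℕ → Set₁
VSet n = Fin n → Set

module _ {n : ℕ} (G : Graph n) where
  open Graph G

  IsTRD : VSet n → Set
  IsTRD S =
    (∀ v → ¬ S v → (∃[ u ] (S u × Adj v u)) × (∃[ w ] (¬ S w × w ≢ v × Adj v w)))
    × (∀ v → S v → ∃[ u ] (S u × u ≢ v × Adj v u))

  _∪_ : VSet n → VSet n → VSet n
  (X ∪ Y) v = X v ⊎ Y v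

  TRCoalition : VSet n → VSet n → Set
  TRCoalition X Y =
    (∀ v → X v → ¬ Y v) × ¬ IsTRD X × ¬ IsTRD Y × IsTRD (X ∪ Y)

  -- A partition of V into k members, given by a class-assignment f : Fin n → Fin k;
  -- member i is {v | f v ≡ i}. Surjectivity makes every member nonempty.
  Member : {k : ℕ} → (Fin n → Fin k) → Fin k → VSet n
  Member f i v = f v ≡ i

  IsTRCPartition : (k : ℕ) → (Fin n → Fin k) → Set
  IsTRCPartition k f =
    (∀ i → ∃[ v ] (f v ≡ i))
    × (∀ i → ¬ IsTRD (Member f i))
    × (∀ i → ∃[ j ] (j ≢ i × TRCoalition (Member f i) (Member f j)))

  CtrEquals : ℕ → Set
  CtrEquals m =
    (Σ (Fin n → Fin m) (IsTRCPartition m))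
    × (∀ k (f : Fin n → Fin k) → IsTRCPartition k f → k ≤ m)

-- Complete bipartite graph K_{p,q} on Fin (p + q): vertices with index < p form one
-- part, the rest (q vertices) the other; u ~ v iff they lie in different parts.
KAdj : (p q : ℕ) → Fin (p + q) → Fin (p + q) → Set
KAdj p q u v = (toℕ u < p × p ≤ toℕ v) ⊎ (p ≤ toℕ u × toℕ v < p)

open import Data.Nat.Properties using (<-irrefl; ≤-trans; <⇒≱)
open import Data.Sum using (inj₁; inj₂)
open import Data.Product using (_,_)

K : (p q : ℕ) → Graph (p + q)
K p q = record
  { Adj = KAdj p q
  ; sym = λ { (inj₁ (a , b)) → inj₂ (b , a) ; (inj₂ (a , b)) → inj₁ (b , a) }
  ; irrefl = λ { (inj₁ (a , b)) → <⇒≱ a b ; (inj₂ (a , b)) → <⇒≱ b a }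
  }

-- No single vertex is a TRD-set, since it has no neighbour inside itself, and a partition of
-- p + q vertices has at most p + q members; so it suffices that the partition into singletons
-- is a trc-partition. In K_{p,q} with p, q ≥ 2 every edge {a, b} is a TRD-set: each vertex is
-- adjacent to a or b, and each vertex has a neighbour on the opposite side other than a and b
-- because that side has a second vertex. Pairing every vertex with a neighbour therefore gives
-- each singleton a coalition partner.
module Submission where

open import Defs
open import Data.Nat using (ℕ; _≤_; _<_; _+_; z≤n; s≤s)
open import Data.Nat.Properties using (≤-trans; <-≤-trans; m≤m+n; +-monoʳ-<; +-cancelˡ-≡; <⇒≱; ≮⇒≥; _<?_)
open import Data.Fin using (Fin; toℕ; fromℕ<; _≟_)
open import Data.Fin.Properties using (toℕ-fromℕ<; fromℕ<-injective; injective⇒≤)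
open import Data.Product using (_×_; _,_; proj₁; proj₂; ∃-syntax)
open import Data.Sum using (_⊎_; inj₁; inj₂)
open import Function using (id; _∘_)
open import Relation.Nullary using (¬_; yes; no)
open import Relation.Binary.PropositionalEquality using (_≡_; _≢_; refl; sym; trans; cong; subst)

Pair : {n : ℕ} → Fin n → Fin n → VSet n
Pair a b v = v ≡ a ⊎ v ≡ b

Pair-comm : ∀ {n} {a b v : Fin n} → Pair a b v → Pair b a v
Pair-comm (inj₁ v≡a) = inj₂ v≡a
Pair-comm (inj₂ v≡b) = inj₁ v≡b

avoid : ∀ {n} {P : Fin n → Set} {y₁ y₂ : Fin n} →
        P y₁ → P y₂ → y₁ ≢ y₂ → ∀ x → ∃[ y ] (P y × y ≢ x)
avoid {y₁ = y₁} Py₁ Py₂ y₁≢y₂ x with y₁ ≟ x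
... | no y₁≢x  = y₁ , Py₁ , y₁≢x
... | yes refl = _ , Py₂ , y₁≢y₂ ∘ sym

surjective⇒≤ : ∀ {n k} (f : Fin n → Fin k) → (∀ i → ∃[ v ] (f v ≡ i)) → k ≤ n
surjective⇒≤ f surj = injective⇒≤ {f = proj₁ ∘ surj} section-injective
  where
  section-injective : ∀ {i j} → proj₁ (surj i) ≡ proj₁ (surj j) → i ≡ j
  section-injective {i} {j} e = trans (sym (proj₂ (surj i))) (trans (cong f e) (proj₂ (surj j)))

module _ {n : ℕ} (G : Graph n) where
  open Graph G using (Adj; irrefl) renaming (sym to Adj-sym)

  IsTRD-cong : ∀ {S T : VSet n} → (∀ {v} → S v → T v) → (∀ {v} → T v → S v) →
               IsTRD G S → IsTRD G T
  IsTRD-cong S⊆T T⊆S (outside , inside) =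
    (λ v v∉T → let (u , Su , vu) , (w , w∉S , w≢v , vw) = outside v (v∉T ∘ S⊆T)
               in (u , S⊆T Su , vu) , (w , w∉S ∘ T⊆S , w≢v , vw))
    , (λ v Tv → let u , Su , u≢v , vu = inside v (T⊆S Tv) in u , S⊆T Su , u≢v , vu)

  singleton-not-TRD : ∀ i → ¬ IsTRD G (_≡ i)
  singleton-not-TRD i (_ , dominated) with dominated i refl
  ... | _ , refl , i≢i , _ = i≢i refl

  edge-isTRD : ∀ {a b} → Adj a b →
               (∀ v → Adj v a ⊎ Adj v b) →
               (∀ v → ∃[ w ] (¬ Pair a b w × Adj v w)) →
               IsTRD G (Pair a b)
  edge-isTRD {a} {b} ab dominated escape = outside , inside
    where
    outside : ∀ v → ¬ Pair a b v → _
    outside v _ with escape v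
    ... | w , w∉ab , vw = dominator , (w , w∉ab , (λ { refl → irrefl vw }) , vw)
      where
      dominator : ∃[ u ] (Pair a b u × Adj v u)
      dominator with dominated v
      ... | inj₁ va = a , inj₁ refl , va
      ... | inj₂ vb = b , inj₂ refl , vb

    inside : ∀ v → Pair a b v → ∃[ u ] (Pair a b u × u ≢ v × Adj v u)
    inside v (inj₁ refl) = b , inj₂ refl , (λ { refl → irrefl ab }) , ab
    inside v (inj₂ refl) = a , inj₁ refl , (λ { refl → irrefl ab }) , Adj-sym ab

  singletons-isTRCPartition : (∀ v → ∃[ w ] (Adj v w × IsTRD G (Pair v w))) →
                              IsTRCPartition G n id
  singletons-isTRCPartition partner = (λ v → v , refl) , singleton-not-TRD , coalition
    where
    coalition : ∀ v → ∃[ w ] (w ≢ v × TRCoalition G (_≡ v) (_≡ w))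
    coalition v with partner v
    ... | w , vw , trd =
      w , (λ { refl → irrefl vw })
        , (λ { _ refl refl → irrefl vw }) , singleton-not-TRD v , singleton-not-TRD w , trd

  trcPartition-size-≤ : ∀ {k} {f : Fin n → Fin k} → IsTRCPartition G k f → k ≤ n
  trcPartition-size-≤ {f = f} (surj , _) = surjective⇒≤ f surj

module CompleteBipartite (p q : ℕ) (2≤p : 2 ≤ p) (2≤q : 2 ≤ q) where

  InA InB : Fin (p + q) → Set
  InA v = toℕ v < p
  InB v = p ≤ toℕ v

  fromℕ<-distinct : ∀ {k l} (k<n : k < p + q) (l<n : l < p + q) → k ≢ l → fromℕ< k<n ≢ fromℕ< l<n
  fromℕ<-distinct k<n l<n k≢l = k≢l ∘ fromℕ<-injective _ _ k<n l<n

  A-index<n : ∀ {k} → k < p → k < p + q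
  A-index<n k<p = <-≤-trans k<p (m≤m+n p q)

  B-index<n : ∀ {k} → k < q → p + k < p + q
  B-index<n = +-monoʳ-< p

  vertexA : ∀ k (k<p : k < p) → InA (fromℕ< (A-index<n k<p))
  vertexA k k<p = subst (_< p) (sym (toℕ-fromℕ< (A-index<n k<p))) k<p

  vertexB : ∀ k (k<q : k < q) → InB (fromℕ< (B-index<n k<q))
  vertexB k k<q = subst (p ≤_) (sym (toℕ-fromℕ< (B-index<n k<q))) (m≤m+n p k)

  otherA : ∀ x → ∃[ w ] (InA w × w ≢ x)
  otherA = avoid (vertexA 0 0<p) (vertexA 1 2≤p)
                 (fromℕ<-distinct (A-index<n 0<p) (A-index<n 2≤p) λ ())
    where
    0<p : 0 < p
    0<p = ≤-trans (s≤s z≤n) 2≤p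

  otherB : ∀ x → ∃[ w ] (InB w × w ≢ x)
  otherB = avoid (vertexB 0 0<q) (vertexB 1 2≤q)
                 (fromℕ<-distinct (B-index<n 0<q) (B-index<n 2≤q) ((λ ()) ∘ +-cancelˡ-≡ p 0 1))
    where
    0<q : 0 < q
    0<q = ≤-trans (s≤s z≤n) 2≤q

  avoidA : ∀ {a b} → InA a → InB b → ∃[ w ] (InA w × ¬ Pair a b w)
  avoidA {a} a∈A b∈B with otherA a
  ... | w , w∈A , w≢a = w , w∈A , λ { (inj₁ w≡a) → w≢a w≡a ; (inj₂ refl) → <⇒≱ w∈A b∈B }

  avoidB : ∀ {a b} → InA a → InB b → ∃[ w ] (InB w × ¬ Pair a b w)
  avoidB {b = b} a∈A b∈B with otherB b
  ... | w , w∈B , w≢b = w , w∈B , λ { (inj₁ refl) → <⇒≱ a∈A w∈B ; (inj₂ w≡b) → w≢b w≡b }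

  crossEdge-isTRD : ∀ {a b} → InA a → InB b → IsTRD (K p q) (Pair a b)
  crossEdge-isTRD {a} {b} a∈A b∈B = edge-isTRD (K p q) (inj₁ (a∈A , b∈B)) dominated escape
    where
    dominated : ∀ v → KAdj p q v a ⊎ KAdj p q v b
    dominated v with toℕ v <? p
    ... | yes v∈A = inj₂ (inj₁ (v∈A , b∈B))
    ... | no v∉A  = inj₁ (inj₂ (≮⇒≥ v∉A , a∈A))

    escape : ∀ v → ∃[ w ] (¬ Pair a b w × KAdj p q v w)
    escape v with toℕ v <? p
    ... | yes v∈A = let w , w∈B , w∉ab = avoidB a∈A b∈B in w , w∉ab , inj₁ (v∈A , w∈B)
    ... | no v∉A  = let w , w∈A , w∉ab = avoidA a∈A b∈B in w , w∉ab , inj₂ (≮⇒≥ v∉A , w∈A)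

  K-edge-isTRD : ∀ {a b} → KAdj p q a b → IsTRD (K p q) (Pair a b)
  K-edge-isTRD (inj₁ (a∈A , b∈B)) = crossEdge-isTRD a∈A b∈B
  K-edge-isTRD (inj₂ (a∈B , b∈A)) = IsTRD-cong (K p q) Pair-comm Pair-comm (crossEdge-isTRD b∈A a∈B)

  K-neighbour : ∀ v → ∃[ w ] KAdj p q v w
  K-neighbour v with toℕ v <? p
  ... | yes v∈A = let w , w∈B , _ = otherB v in w , inj₁ (v∈A , w∈B)
  ... | no v∉A  = let w , w∈A , _ = otherA v in w , inj₂ (≮⇒≥ v∉A , w∈A)

  K-edgePartner : ∀ v → ∃[ w ] (KAdj p q v w × IsTRD (K p q) (Pair v w))
  K-edgePartner v = let w , vw = K-neighbour v in w , vw , K-edge-isTRD vw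

mainTheorem11 : (p q : ℕ) → 2 ≤ p → p ≤ q → CtrEquals (K p q) (p + q)
mainTheorem11 p q 2≤p p≤q =
  (id , singletons-isTRCPartition (K p q) K-edgePartner) , λ _ _ → trcPartition-size-≤ (K p q)
  where open CompleteBipartite p q 2≤p (≤-trans 2≤p p≤q)
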